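{- For every positive integer $n$, $\sigma\overline{\mathrm{mex}}(n)$ is even, where $\sigma\overline{\mathrm{mex}}(n)=\sum_{\pi}\overline{\mathrm{mex}}(\pi)$, the sum being over all overpartitions $\pi$ of $n$.
   Context: An overpartition of a positive integer $n$ is a non-increasing sequence of positive integers summing to $n$ in which the first occurrence of each number may (or may not) be overlined. For an overpartition $\pi$, $\overline{\mathrm{mex}}(\pi)$ is the smallest positive integer that does not occur as a part of $\pi$, whether overlined or non-overlined. -}

module Defs where

open import Data.Nat using (ℕ; zero; suc; _+_; _≤?_; _≟_)
open import Data.Bool using (Bool; true; false; if_then_else_)
open import Data.List using (List; []; _∷_; map; concatMap; upTo; _++_)
open import Data.Bool.ListAction using (any)
open import Data.Nat.ListAction using (sum)
open import Data.Product using (_×_; _,_; proj₁)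
open import Relation.Nullary.Decidable using (⌊_⌋)

-- An overpartition is represented as a list of parts (value , overlined?)
-- listed in non-increasing order of value; only the first occurrence of a
-- value may carry the flag 'true' (overlined).
OverPart : Set
OverPart = List (ℕ × Bool)

-- partitionsBounded fuel n b : all partitions of n (non-increasing lists of
-- positive integers) with every part ≤ b.  fuel ≥ n guarantees completeness.
partitionsBounded : ℕ → ℕ → ℕ → List (List ℕ)
partitionsBounded _ zero _ = [] ∷ []
partitionsBounded zero (suc _) _ = []
partitionsBounded (suc f) n b =
  concatMap (λ k → let p = suc k in
    if ⌊ p ≤? b ⌋ then (if ⌊ p ≤? n ⌋
      then map (p ∷_) (partitionsBounded f (n Data.Nat.∸ p) p) else [])
    else [])
  (upTo n)

partitions : ℕ → List (List ℕ)
partitions n = partitionsBounded n n n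

overlinings : List ℕ → OverPart
            → List OverPart
overlinings [] _ = [] ∷ []
overlinings (p ∷ ps) [] =
  map ((p , false) ∷_) (overlinings ps ((p , false) ∷ []))
  ++ map ((p , true) ∷_) (overlinings ps ((p , true) ∷ []))
overlinings (p ∷ ps) (q ∷ _) with ⌊ p ≟ proj₁ q ⌋
... | true  = map ((p , false) ∷_) (overlinings ps ((p , false) ∷ []))
... | false =
  map ((p , false) ∷_) (overlinings ps ((p , false) ∷ []))
  ++ map ((p , true) ∷_) (overlinings ps ((p , true) ∷ []))

overpartitions : ℕ → List OverPart
overpartitions n = concatMap (λ p → overlinings p []) (partitions n)

occurs : ℕ → OverPart → Bool
occurs k π = any (λ q → ⌊ k ≟ proj₁ q ⌋) π

-- smallest positive integer not occurring as a part: search from 1 upward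
-- (fuel = length bound; a list of length L misses some value in 1..L+1)
mexFrom : ℕ → ℕ → OverPart → ℕ
mexFrom zero k _ = k
mexFrom (suc f) k π = if occurs k π then mexFrom f (suc k) π else k

mexBar : OverPart → ℕ
mexBar π = mexFrom (Data.List.length π) 1 π

sigmaMexBar : ℕ → ℕ
sigmaMexBar n = sum (map mexBar (overpartitions n))

{-# OPTIONS --safe #-}
-- Overlining or un-overlining the largest part is an involution on the
-- overpartitions of n without fixed points when n ≥ 1, and it does not change
-- mex-bar, which ignores overlines. Hence the overpartitions of n split into
-- pairs with equal mex-bar.
module Submission where

open import Defs
open import Data.Nat using (ℕ; zero; suc; _*_; _+_; _∸_; _≤?_)
open import Data.Nat.Divisibility using (_∣_; _∣0; ∣m∣n⇒∣m+n; m∣m*n; quotient; m∣n⇒n≡m*quotient)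
open import Data.Nat.ListAction using (sum)
open import Data.Nat.ListAction.Properties using (sum-++)
open import Data.Nat.Properties using (+-identityʳ)
open import Data.Bool using (true; false; if_then_else_)
open import Data.List using (List; []; _∷_; map; concatMap; _++_; upTo; length)
open import Data.List.Properties using (map-++; map-cong; map-∘)
open import Data.List.Relation.Unary.All as All using (All; []; _∷_)
open import Data.List.Relation.Unary.All.Properties using (concat⁺; map⁺)
open import Data.Product using (∃-syntax; _,_)
open import Relation.Nullary using (contradiction)
open import Relation.Nullary.Decidable using (⌊_⌋)
open import Relation.Binary.PropositionalEquality
  using (_≡_; _≢_; refl; sym; cong; subst; module ≡-Reasoning)

overlinings-flag-irrelevant : ∀ ps {p b b' qs qs'} →
  overlinings ps ((p , b) ∷ qs) ≡ overlinings ps ((p , b') ∷ qs')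
overlinings-flag-irrelevant []      = refl
overlinings-flag-irrelevant (_ ∷ _) = refl

mexFrom-flag-irrelevant : ∀ f k {p b b' π} →
  mexFrom f k ((p , b) ∷ π) ≡ mexFrom f k ((p , b') ∷ π)
mexFrom-flag-irrelevant zero    k = refl
mexFrom-flag-irrelevant (suc f) k {p} {b} {π = π} =
  cong (if occurs k ((p , b) ∷ π) then_else k) (mexFrom-flag-irrelevant f (suc k))

totalMex : List OverPart → ℕ
totalMex πs = sum (map mexBar πs)

totalMex-++ : ∀ πs πs' → totalMex (πs ++ πs') ≡ totalMex πs + totalMex πs'
totalMex-++ πs πs' rewrite map-++ mexBar πs πs' = sum-++ (map mexBar πs) (map mexBar πs')

totalMex-flag-irrelevant : ∀ p b b' πs →
  totalMex (map ((p , b) ∷_) πs) ≡ totalMex (map ((p , b') ∷_) πs)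
totalMex-flag-irrelevant p b b' πs = cong sum (begin
  map mexBar (map ((p , b) ∷_) πs)    ≡⟨ map-∘ πs ⟨
  map (λ π → mexBar ((p , b) ∷ π)) πs  ≡⟨ map-cong (λ π → mexFrom-flag-irrelevant (suc (length π)) 1) πs ⟩
  map (λ π → mexBar ((p , b') ∷ π)) πs ≡⟨ map-∘ πs ⟩
  map mexBar (map ((p , b') ∷_) πs)   ∎)
  where open ≡-Reasoning

totalMex-overlinings-∷ : ∀ p ps →
  totalMex (overlinings (p ∷ ps) []) ≡ 2 * totalMex (map ((p , false) ∷_) (overlinings ps ((p , false) ∷ [])))
totalMex-overlinings-∷ p ps = begin
  totalMex (unbarred ++ map ((p , true) ∷_) (overlinings ps ((p , true) ∷ [])))
    ≡⟨ cong (λ πs → totalMex (unbarred ++ map ((p , true) ∷_) πs)) (overlinings-flag-irrelevant ps) ⟨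
  totalMex (unbarred ++ map ((p , true) ∷_) πs)  ≡⟨ totalMex-++ unbarred (map ((p , true) ∷_) πs) ⟩
  totalMex unbarred + totalMex (map ((p , true) ∷_) πs)
    ≡⟨ cong (totalMex unbarred +_) (totalMex-flag-irrelevant p true false πs) ⟩
  totalMex unbarred + totalMex unbarred          ≡⟨ cong (totalMex unbarred +_) (+-identityʳ _) ⟨
  2 * totalMex unbarred                          ∎
  where
  open ≡-Reasoning
  πs unbarred : List OverPart
  πs       = overlinings ps ((p , false) ∷ [])
  unbarred = map ((p , false) ∷_) πs

2∣totalMex-overlinings : ∀ {ps} → ps ≢ [] → 2 ∣ totalMex (overlinings ps [])
2∣totalMex-overlinings {[]}     ps≢[] = contradiction refl ps≢[]
2∣totalMex-overlinings {p ∷ ps} _ = subst (2 ∣_) (sym (totalMex-overlinings-∷ p ps))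
  (m∣m*n (totalMex (map ((p , false) ∷_) (overlinings ps ((p , false) ∷ [])))))

∣totalMex-concatMap : ∀ {A : Set} {d} (h : A → List OverPart) xs →
  All (λ x → d ∣ totalMex (h x)) xs → d ∣ totalMex (concatMap h xs)
∣totalMex-concatMap h []       []         = _ ∣0
∣totalMex-concatMap h (x ∷ xs) (d∣ ∷ d∣s) rewrite totalMex-++ (h x) (concatMap h xs) =
  ∣m∣n⇒∣m+n d∣ (∣totalMex-concatMap h xs d∣s)

partitionsBounded-nonEmpty : ∀ f m b → All (_≢ []) (partitionsBounded (suc f) (suc m) b)
partitionsBounded-nonEmpty f m b = concat⁺ (map⁺ (All.universal branch-nonEmpty (upTo (suc m))))
  where
  if⁺ : ∀ c {πs : List (List ℕ)} → All (_≢ []) πs → All (_≢ []) (if c then πs else [])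
  if⁺ true  all = all
  if⁺ false _   = []

  cons-nonEmpty : ∀ p (πs : List (List ℕ)) → All (_≢ []) (map (p ∷_) πs)
  cons-nonEmpty p []       = []
  cons-nonEmpty p (_ ∷ πs) = (λ ()) ∷ cons-nonEmpty p πs

  branch-nonEmpty : ∀ k → All (_≢ [])
    (if ⌊ suc k ≤? b ⌋ then (if ⌊ suc k ≤? suc m ⌋
      then map (suc k ∷_) (partitionsBounded f (m ∸ k) (suc k)) else []) else [])
  branch-nonEmpty k = if⁺ ⌊ suc k ≤? b ⌋ (if⁺ ⌊ suc k ≤? suc m ⌋
    (cons-nonEmpty (suc k) (partitionsBounded f (m ∸ k) (suc k))))

theorem1p6 : (n : ℕ) → 1 Data.Nat.≤ n → ∃[ k ] sigmaMexBar n ≡ 2 * k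
theorem1p6 (suc m) _ = quotient 2∣σ , m∣n⇒n≡m*quotient 2∣σ
  where
  2∣σ : 2 ∣ sigmaMexBar (suc m)
  2∣σ = ∣totalMex-concatMap (λ ps → overlinings ps []) (partitions (suc m))
          (All.map 2∣totalMex-overlinings (partitionsBounded-nonEmpty m m (suc m)))
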